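{- Let $(B_n)_{n\ge0}$ and $(C_n)_{n\ge0}$ be the balancing and Lucas-balancing numbers. For every integer $n\ge 0$, $$\sum_{k=0}^n\binom{n}{k}(-1)^{n-k}3^kB_k=\begin{cases}2^{3n/2}B_n&\text{if $n$ is even},\\ 2^{3(n-1)/2}C_n&\text{if $n$ is odd},\end{cases}$$ and $$\sum_{k=0}^n\binom{n}{k}(-1)^{n-k}3^kC_k=\begin{cases}2^{3n/2}C_n&\text{if $n$ is even},\\ 2^{3(n+1)/2}B_n&\text{if $n$ is odd}.\end{cases}$$
   Context: The balancing numbers are defined by $B_0=0$, $B_1=1$, $B_n=6B_{n-1}-B_{n-2}$ for $n\ge 2$. The Lucas-balancing numbers are defined by $C_0=1$, $C_1=3$, $C_n=6C_{n-1}-C_{n-2}$ for $n\ge 2$. -}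

module Defs where

open import Data.Nat as ℕ using (ℕ; zero; suc; _∸_)
open import Data.Nat.Combinatorics using () renaming (_C_ to binom)
open import Data.Integer using (ℤ; +_; -_; _+_; _-_; _*_; _^_)

B : ℕ → ℤ
B zero = + 0
B (suc zero) = + 1
B (suc (suc n)) = + 6 * B (suc n) - B n

C : ℕ → ℤ
C zero = + 1
C (suc zero) = + 3
C (suc (suc n)) = + 6 * C (suc n) - C n

sumTo : ℕ → (ℕ → ℤ) → ℤ
sumTo zero f = f zero
sumTo (suc n) f = sumTo n f + f (suc n)

binomTransform : (ℕ → ℤ) → ℕ → ℤ
binomTransform X n = sumTo n (λ k → + (binom n k) * ((- + 1) ^ (n ∸ k)) * ((+ 3) ^ k) * X k)

{-# OPTIONS --safe #-}

-- For the transform T X n = Σ binom(n,k) a^(n-k) b^k X_k, Pascal's rule gives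
-- T X (n+1) = a T X n + b T (X ∘ suc) n.  With (a,b) = (-1,3) and the shifts
-- B_{k+1} = 3B_k + C_k, C_{k+1} = 8B_k + 3C_k, the pair (T B, T C) thus steps by the
-- matrix [[8,3],[24,8]], which sends P·(B_n, C_n) to P·(C_{n+1}, 8B_{n+1}) and that in
-- turn to 8P·(B_{n+2}, C_{n+2}).

module Submission where

open import Defs
open import Data.Nat as ℕ using (ℕ; zero; suc; _∸_)
import Data.Nat.Properties as ℕ
open import Data.Nat.Combinatorics using (k>n⇒nCk≡0; nCk+nC[k+1]≡[n+1]C[k+1]) renaming (_C_ to binom)
open import Data.Integer using (ℤ; +_; -_; _+_; _-_; _*_; _^_)
open import Data.Integer.Properties using (pos-+; +-assoc; +-identityʳ; *-identityˡ; *-distribˡ-+)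
open import Data.Integer.Tactic.RingSolver using (solve-∀)
open import Data.Product using (_×_; _,_; proj₁; proj₂; map₂)
open import Data.Sum using (inj₁; inj₂)
open import Function using (_∘_)
open import Relation.Binary.PropositionalEquality using (_≡_; refl; sym; trans; cong; cong₂; subst₂; module ≡-Reasoning)
open ≡-Reasoning

sumTo-cong : ∀ n {f g : ℕ → ℤ} → (∀ k → f k ≡ g k) → sumTo n f ≡ sumTo n g
sumTo-cong zero    f≗g = f≗g zero
sumTo-cong (suc n) f≗g = cong₂ _+_ (sumTo-cong n f≗g) (f≗g (suc n))

sumTo-+ : ∀ n (f g : ℕ → ℤ) → sumTo n (λ k → f k + g k) ≡ sumTo n f + sumTo n g
sumTo-+ zero    f g = refl
sumTo-+ (suc n) f g = trans (cong (_+ (f (suc n) + g (suc n))) (sumTo-+ n f g))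
                            (interchange (sumTo n f) (sumTo n g) (f (suc n)) (g (suc n)))
  where
  interchange : ∀ x y u v → (x + y) + (u + v) ≡ (x + u) + (y + v)
  interchange = solve-∀

sumTo-*ˡ : ∀ n c (f : ℕ → ℤ) → sumTo n (λ k → c * f k) ≡ c * sumTo n f
sumTo-*ˡ zero    c f = refl
sumTo-*ˡ (suc n) c f = trans (cong (_+ c * f (suc n)) (sumTo-*ˡ n c f))
                             (sym (*-distribˡ-+ c (sumTo n f) (f (suc n))))

sumTo-suc-head : ∀ n (f : ℕ → ℤ) → sumTo (suc n) f ≡ f 0 + sumTo n (f ∘ suc)
sumTo-suc-head zero    f = refl
sumTo-suc-head (suc n) f = trans (cong (_+ f (suc (suc n))) (sumTo-suc-head n f))
                                 (+-assoc (f 0) (sumTo n (f ∘ suc)) (f (suc (suc n))))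

binomialWeight : ℤ → ℤ → ℕ → ℕ → ℤ
binomialWeight a b n k = + binom n k * a ^ (n ∸ k) * b ^ k

-- binomTransform X is binomialTransform (- + 1) (+ 3) X definitionally.
binomialTransform : ℤ → ℤ → (ℕ → ℤ) → ℕ → ℤ
binomialTransform a b X n = sumTo n (λ k → binomialWeight a b n k * X k)

binomialWeight-zero : ∀ a b n → binomialWeight a b (suc n) 0 ≡ a * binomialWeight a b n 0
binomialWeight-zero a b n = regroup a (a ^ n)
  where
  regroup : ∀ a p → + 1 * (a * p) * + 1 ≡ a * (+ 1 * p * + 1)
  regroup = solve-∀

binomialWeight-vanishes : ∀ a b n → binomialWeight a b n (suc n) ≡ + 0
binomialWeight-vanishes a b n
  rewrite k>n⇒nCk≡0 {n} {suc n} (ℕ.n<1+n n) = refl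

-- n ∸ k ≡ suc (n ∸ suc k) fails when k ≥ n, but then binom n (suc k) ≡ 0.
binom-suc-*-pow-∸ : ∀ a n k → + binom n (suc k) * a ^ (n ∸ k) ≡ + binom n (suc k) * (a * a ^ (n ∸ suc k))
binom-suc-*-pow-∸ a n k with ℕ.<-≤-connex k n
... | inj₁ k<n = cong (λ e → + binom n (suc k) * a ^ e) (ℕ.+-∸-assoc 1 k<n)
... | inj₂ n≤k rewrite k>n⇒nCk≡0 {n} {suc k} (ℕ.s≤s n≤k) = refl

binomialWeight-pascal : ∀ a b n k →
  binomialWeight a b (suc n) (suc k) ≡ b * binomialWeight a b n k + a * binomialWeight a b n (suc k)
binomialWeight-pascal a b n k = begin
    + binom (suc n) (suc k) * a ^ (n ∸ k) * (b * b ^ k)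
  ≡⟨ cong (λ c → c * a ^ (n ∸ k) * (b * b ^ k)) pascal ⟩
    (+ binom n k + + binom n (suc k)) * a ^ (n ∸ k) * (b * b ^ k)
  ≡⟨ split (+ binom n k) (+ binom n (suc k)) (a ^ (n ∸ k)) b (b ^ k) ⟩
    b * binomialWeight a b n k + + binom n (suc k) * a ^ (n ∸ k) * (b * b ^ k)
  ≡⟨ cong (λ c → b * binomialWeight a b n k + c * (b * b ^ k)) (binom-suc-*-pow-∸ a n k) ⟩
    b * binomialWeight a b n k + + binom n (suc k) * (a * a ^ (n ∸ suc k)) * (b * b ^ k)
  ≡⟨ cong (_+_ (b * binomialWeight a b n k)) (regroup (+ binom n (suc k)) a (a ^ (n ∸ suc k)) (b * b ^ k)) ⟩
    b * binomialWeight a b n k + a * binomialWeight a b n (suc k)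
  ∎
  where
  pascal : + binom (suc n) (suc k) ≡ + binom n k + + binom n (suc k)
  pascal = trans (cong +_ (sym (nCk+nC[k+1]≡[n+1]C[k+1] n k))) (pos-+ (binom n k) (binom n (suc k)))
  split : ∀ c d p b q → (c + d) * p * (b * q) ≡ b * (c * p * q) + d * p * (b * q)
  split = solve-∀
  regroup : ∀ c a p q → c * (a * p) * q ≡ a * (c * p * q)
  regroup = solve-∀

binomialTransform-suc : ∀ a b (X : ℕ → ℤ) n →
  binomialTransform a b X (suc n) ≡ a * binomialTransform a b X n + b * binomialTransform a b (X ∘ suc) n
binomialTransform-suc a b X n = begin
    binomialTransform a b X (suc n)
  ≡⟨ sumTo-suc-head n (λ k → w (suc n) k * X k) ⟩
    w (suc n) 0 * X 0 + sumTo n (λ k → w (suc n) (suc k) * X (suc k))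
  ≡⟨ cong₂ _+_ (cong (_* X 0) (binomialWeight-zero a b n)) (sumTo-cong n pascal-term) ⟩
    a * w n 0 * X 0 + sumTo n (λ k → a * (w n (suc k) * X (suc k)) + b * (w n k * X (suc k)))
  ≡⟨ cong (_+_ (a * w n 0 * X 0)) (trans (sumTo-+ n _ _) (cong₂ _+_ (sumTo-*ˡ n a _) (sumTo-*ˡ n b _))) ⟩
    a * w n 0 * X 0 + (a * S + b * binomialTransform a b (X ∘ suc) n)
  ≡⟨ factor a (w n 0) (X 0) S (b * binomialTransform a b (X ∘ suc) n) ⟩
    a * (w n 0 * X 0 + S) + b * binomialTransform a b (X ∘ suc) n
  ≡⟨ cong (λ s → a * s + b * binomialTransform a b (X ∘ suc) n) (sym (sumTo-suc-head n (λ k → w n k * X k))) ⟩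
    a * (binomialTransform a b X n + w n (suc n) * X (suc n)) + b * binomialTransform a b (X ∘ suc) n
  ≡⟨ cong (λ s → a * s + b * binomialTransform a b (X ∘ suc) n) drop-vanishing-term ⟩
    a * binomialTransform a b X n + b * binomialTransform a b (X ∘ suc) n
  ∎
  where
  w : ℕ → ℕ → ℤ
  w = binomialWeight a b
  S : ℤ
  S = sumTo n (λ k → w n (suc k) * X (suc k))
  pascal-term : ∀ k → w (suc n) (suc k) * X (suc k) ≡ a * (w n (suc k) * X (suc k)) + b * (w n k * X (suc k))
  pascal-term k = trans (cong (_* X (suc k)) (binomialWeight-pascal a b n k))
                        (distribute b a (w n k) (w n (suc k)) (X (suc k)))
    where
    distribute : ∀ b a p q x → (b * p + a * q) * x ≡ a * (q * x) + b * (p * x)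
    distribute = solve-∀
  factor : ∀ a p x s t → a * p * x + (a * s + t) ≡ a * (p * x + s) + t
  factor = solve-∀
  drop-vanishing-term : binomialTransform a b X n + w n (suc n) * X (suc n) ≡ binomialTransform a b X n
  drop-vanishing-term = trans (cong (λ c → binomialTransform a b X n + c * X (suc n)) (binomialWeight-vanishes a b n))
                              (+-identityʳ (binomialTransform a b X n))

binomialTransform-linear : ∀ a b {X Y Z : ℕ → ℤ} u v n → (∀ k → X k ≡ u * Y k + v * Z k) →
  binomialTransform a b X n ≡ u * binomialTransform a b Y n + v * binomialTransform a b Z n
binomialTransform-linear a b {X} {Y} {Z} u v n X≗uY+vZ =
  trans (sumTo-cong n (λ k → trans (cong (binomialWeight a b n k *_) (X≗uY+vZ k))
                                   (distribute (binomialWeight a b n k) u v (Y k) (Z k))))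
        (trans (sumTo-+ n _ _) (cong₂ _+_ (sumTo-*ˡ n u _) (sumTo-*ˡ n v _)))
  where
  distribute : ∀ w u v y z → w * (u * y + v * z) ≡ u * (w * y) + v * (w * z)
  distribute = solve-∀

B-suc×C-suc : ∀ k → B (suc k) ≡ + 3 * B k + C k × C (suc k) ≡ + 8 * B k + + 3 * C k
B-suc×C-suc zero = refl , refl
B-suc×C-suc (suc k) with B-suc×C-suc k
... | B≡ , C≡ rewrite B≡ | C≡ = B-step (B k) (C k) , C-step (B k) (C k)
  where
  B-step : ∀ b c → + 6 * (+ 3 * b + c) - b ≡ + 3 * (+ 3 * b + c) + (+ 8 * b + + 3 * c)
  B-step = solve-∀
  C-step : ∀ b c → + 6 * (+ 8 * b + + 3 * c) - c ≡ + 8 * (+ 3 * b + c) + + 3 * (+ 8 * b + + 3 * c)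
  C-step = solve-∀

B-suc : ∀ k → B (suc k) ≡ + 3 * B k + C k
B-suc = proj₁ ∘ B-suc×C-suc

C-suc : ∀ k → C (suc k) ≡ + 8 * B k + + 3 * C k
C-suc = proj₂ ∘ B-suc×C-suc

binomTransform-B-suc : ∀ n → binomTransform B (suc n) ≡ + 8 * binomTransform B n + + 3 * binomTransform C n
binomTransform-B-suc n = begin
    binomTransform B (suc n)
  ≡⟨ binomialTransform-suc (- + 1) (+ 3) B n ⟩
    - + 1 * binomTransform B n + + 3 * binomialTransform (- + 1) (+ 3) (B ∘ suc) n
  ≡⟨ cong (_+_ (- + 1 * binomTransform B n) ∘ (+ 3 *_))
          (binomialTransform-linear (- + 1) (+ 3) (+ 3) (+ 1) n B-suc′) ⟩
    - + 1 * binomTransform B n + + 3 * (+ 3 * binomTransform B n + + 1 * binomTransform C n)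
  ≡⟨ collect (binomTransform B n) (binomTransform C n) ⟩
    + 8 * binomTransform B n + + 3 * binomTransform C n
  ∎
  where
  B-suc′ : ∀ k → B (suc k) ≡ + 3 * B k + + 1 * C k
  B-suc′ k = trans (B-suc k) (cong (_+_ (+ 3 * B k)) (sym (*-identityˡ (C k))))
  collect : ∀ x y → - + 1 * x + + 3 * (+ 3 * x + + 1 * y) ≡ + 8 * x + + 3 * y
  collect = solve-∀

binomTransform-C-suc : ∀ n → binomTransform C (suc n) ≡ + 24 * binomTransform B n + + 8 * binomTransform C n
binomTransform-C-suc n = begin
    binomTransform C (suc n)
  ≡⟨ binomialTransform-suc (- + 1) (+ 3) C n ⟩
    - + 1 * binomTransform C n + + 3 * binomialTransform (- + 1) (+ 3) (C ∘ suc) n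
  ≡⟨ cong (_+_ (- + 1 * binomTransform C n) ∘ (+ 3 *_))
          (binomialTransform-linear (- + 1) (+ 3) (+ 8) (+ 3) n C-suc) ⟩
    - + 1 * binomTransform C n + + 3 * (+ 8 * binomTransform B n + + 3 * binomTransform C n)
  ≡⟨ collect (binomTransform B n) (binomTransform C n) ⟩
    + 24 * binomTransform B n + + 8 * binomTransform C n
  ∎
  where
  collect : ∀ x y → - + 1 * y + + 3 * (+ 8 * x + + 3 * y) ≡ + 24 * x + + 8 * y
  collect = solve-∀

Aligned : ℤ → ℕ → Set
Aligned P n = binomTransform B n ≡ P * B n × binomTransform C n ≡ P * C n

Swapped : ℤ → ℕ → Set
Swapped P n = binomTransform B n ≡ P * C n × binomTransform C n ≡ + 8 * P * B n

Aligned⇒Swapped-suc : ∀ P n → Aligned P n → Swapped P (suc n)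
Aligned⇒Swapped-suc P n (TB≡ , TC≡) =
  (begin
    binomTransform B (suc n)
  ≡⟨ binomTransform-B-suc n ⟩
    + 8 * binomTransform B n + + 3 * binomTransform C n
  ≡⟨ cong₂ (λ x y → + 8 * x + + 3 * y) TB≡ TC≡ ⟩
    + 8 * (P * B n) + + 3 * (P * C n)
  ≡⟨ factorB P (B n) (C n) ⟩
    P * (+ 8 * B n + + 3 * C n)
  ≡⟨ cong (P *_) (sym (C-suc n)) ⟩
    P * C (suc n)
  ∎) ,
  (begin
    binomTransform C (suc n)
  ≡⟨ binomTransform-C-suc n ⟩
    + 24 * binomTransform B n + + 8 * binomTransform C n
  ≡⟨ cong₂ (λ x y → + 24 * x + + 8 * y) TB≡ TC≡ ⟩
    + 24 * (P * B n) + + 8 * (P * C n)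
  ≡⟨ factorC P (B n) (C n) ⟩
    + 8 * P * (+ 3 * B n + C n)
  ≡⟨ cong (+ 8 * P *_) (sym (B-suc n)) ⟩
    + 8 * P * B (suc n)
  ∎)
  where
  factorB : ∀ p b c → + 8 * (p * b) + + 3 * (p * c) ≡ p * (+ 8 * b + + 3 * c)
  factorB = solve-∀
  factorC : ∀ p b c → + 24 * (p * b) + + 8 * (p * c) ≡ + 8 * p * (+ 3 * b + c)
  factorC = solve-∀

Swapped⇒Aligned-suc : ∀ P n → Swapped P n → Aligned (+ 8 * P) (suc n)
Swapped⇒Aligned-suc P n (TB≡ , TC≡) =
  (begin
    binomTransform B (suc n)
  ≡⟨ binomTransform-B-suc n ⟩
    + 8 * binomTransform B n + + 3 * binomTransform C n
  ≡⟨ cong₂ (λ x y → + 8 * x + + 3 * y) TB≡ TC≡ ⟩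
    + 8 * (P * C n) + + 3 * (+ 8 * P * B n)
  ≡⟨ factorB P (B n) (C n) ⟩
    + 8 * P * (+ 3 * B n + C n)
  ≡⟨ cong (+ 8 * P *_) (sym (B-suc n)) ⟩
    + 8 * P * B (suc n)
  ∎) ,
  (begin
    binomTransform C (suc n)
  ≡⟨ binomTransform-C-suc n ⟩
    + 24 * binomTransform B n + + 8 * binomTransform C n
  ≡⟨ cong₂ (λ x y → + 24 * x + + 8 * y) TB≡ TC≡ ⟩
    + 24 * (P * C n) + + 8 * (+ 8 * P * B n)
  ≡⟨ factorC P (B n) (C n) ⟩
    + 8 * P * (+ 8 * B n + + 3 * C n)
  ≡⟨ cong (+ 8 * P *_) (sym (C-suc n)) ⟩
    + 8 * P * C (suc n)
  ∎)
  where
  factorB : ∀ p b c → + 8 * (p * c) + + 3 * (+ 8 * p * b) ≡ + 8 * p * (+ 3 * b + c)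
  factorB = solve-∀
  factorC : ∀ p b c → + 24 * (p * c) + + 8 * (+ 8 * p * b) ≡ + 8 * p * (+ 8 * b + + 3 * c)
  factorC = solve-∀

2^[3*suc] : ∀ m → (+ 2) ^ (3 ℕ.* suc m) ≡ + 8 * (+ 2) ^ (3 ℕ.* m)
2^[3*suc] m = trans (cong ((+ 2) ^_) (ℕ.*-suc 3 m)) (cube ((+ 2) ^ (3 ℕ.* m)))
  where
  cube : ∀ x → + 2 * (+ 2 * (+ 2 * x)) ≡ + 8 * x
  cube = solve-∀

binomTransform-even : ∀ m → Aligned ((+ 2) ^ (3 ℕ.* m)) (2 ℕ.* m)
binomTransform-odd  : ∀ m → Swapped ((+ 2) ^ (3 ℕ.* m)) (suc (2 ℕ.* m))

binomTransform-even zero    = refl , refl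
binomTransform-even (suc m) =
  subst₂ Aligned (sym (2^[3*suc] m)) (sym (ℕ.*-suc 2 m))
         (Swapped⇒Aligned-suc ((+ 2) ^ (3 ℕ.* m)) (suc (2 ℕ.* m)) (binomTransform-odd m))

binomTransform-odd m = Aligned⇒Swapped-suc ((+ 2) ^ (3 ℕ.* m)) (2 ℕ.* m) (binomTransform-even m)

proposition3 : (∀ (m : ℕ) →
                  binomTransform B (2 ℕ.* m) ≡ (+ 2) ^ (3 ℕ.* m) * B (2 ℕ.* m)
                  × binomTransform C (2 ℕ.* m) ≡ (+ 2) ^ (3 ℕ.* m) * C (2 ℕ.* m))
               × (∀ (m : ℕ) →
                  binomTransform B (suc (2 ℕ.* m)) ≡ (+ 2) ^ (3 ℕ.* m) * C (suc (2 ℕ.* m))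
                  × binomTransform C (suc (2 ℕ.* m)) ≡ (+ 2) ^ (3 ℕ.* suc m) * B (suc (2 ℕ.* m)))
proposition3 = binomTransform-even , λ m →
  map₂ (λ TC≡ → trans TC≡ (cong (_* B (suc (2 ℕ.* m))) (sym (2^[3*suc] m)))) (binomTransform-odd m)
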